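{- Let $A=(a_{ij})$ be an $n\times n$ $(0,1)$-matrix representing a binary relation on $\{1,\dots,n\}$. The matrix $T=(t_{ij})$ output by Algorithm 1 (described in the context) on input $A$ represents a transitive relation, i.e. whenever $t_{ij}=1$ and $t_{jk}=1$ we have $t_{ik}=1$.
   Context: Algorithm 1 modifies $A$ in place and returns the final matrix as $T$: for $i=1,2,\dots,n$ (in increasing order), for $j=1,2,\dots,n$ with $j\neq i$ (in increasing order), if currently $a_{ij}=1$, then for $k=1,2,\dots,n$: (a) if $k\neq j$ and currently $a_{ik}=0$, set $a_{jk}:=0$; (b) if $k\neq i$ and currently $a_{kj}=0$, set $a_{ki}:=0$. -}

module Defs where

open import Data.Nat using (ℕ)
open import Data.Fin using (Fin; _≟_)
open import Data.Bool using (Bool; true; false; if_then_else_)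
open import Data.List using (List; foldl; allFin)
open import Relation.Nullary using (does)

-- An n × n (0,1)-matrix: entry a i j ∈ {false = 0, true = 1}.
Matrix : ℕ → Set
Matrix n = Fin n → Fin n → Bool

clear : ∀ {n} → Fin n → Fin n → Matrix n → Matrix n
clear p q a r s = if does (r ≟ p) then (if does (s ≟ q) then false else a r s) else a r s

stepA : ∀ {n} → Fin n → Fin n → Fin n → Matrix n → Matrix n
stepA i j k a = if does (k ≟ j) then a else (if a i k then a else clear j k a)

stepB : ∀ {n} → Fin n → Fin n → Fin n → Matrix n → Matrix n
stepB i j k a = if does (k ≟ i) then a else (if a k j then a else clear k i a)

stepK : ∀ {n} → Fin n → Fin n → Matrix n → Fin n → Matrix n
stepK i j a k = stepB i j k (stepA i j k a)

stepJ : ∀ {n} → Fin n → Matrix n → Fin n → Matrix n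
stepJ {n} i a j =
  if does (j ≟ i) then a
  else (if a i j then foldl (stepK i j) a (allFin n) else a)

stepI : ∀ {n} → Matrix n → Fin n → Matrix n
stepI {n} a i = foldl (stepJ i) a (allFin n)

algorithm1 : ∀ {n} → Matrix n → Matrix n
algorithm1 {n} a = foldl stepI a (allFin n)

Transitive : ∀ {n} → Matrix n → Set
Transitive {n} t = ∀ (i j k : Fin n) → t i j ≡ true → t j k ≡ true → t i k ≡ true
  where open import Relation.Binary.PropositionalEquality using (_≡_)

-- Call a pair (i, j) closed in a matrix a if a_ij = 1 implies that row j is contained in row i
-- and column i in column j; a matrix all of whose pairs are closed is transitive. The body for
-- (i, j) with i ≠ j and a_ij = 1 prunes a to the entries compatible with (i, j): it deletes a_jk
-- unless a_ik = 1 and a_ki unless a_kj = 1, which makes (i, j) closed. Every deletion is forced by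
-- transitivity through (i, j), so pairs closed earlier in the lexicographic order stay closed, and
-- after the last pair the output is transitive.
module Submission where

open import Data.Nat using (ℕ; zero; suc; _+_; _<_)
open import Data.Nat.Properties using (+-identityʳ; +-suc; n≮0; m<1+n⇒m<n∨m≡n)
open import Data.Fin using (Fin; toℕ; _≟_; zero; suc)
open import Data.Fin.Properties using (toℕ-injective; toℕ<n)
open import Data.Bool using (Bool; true; false; if_then_else_)
open import Data.List using (foldl; allFin; tabulate)
open import Data.Product using (_×_; _,_; proj₁; proj₂)
open import Data.Sum using (_⊎_; inj₁; inj₂)
open import Data.Empty using (⊥-elim)
open import Function using (id; _∘_)
open import Relation.Nullary using (Dec; yes; no; does; ¬_)
open import Relation.Nullary.Decidable using (dec-true)
open import Relation.Binary.PropositionalEquality using (_≡_; _≢_; refl; sym; trans; subst; ≢-sym)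
open import Defs

foldl-tabulate-induction : ∀ {A : Set} {n} (f : A → Fin n → A) (P : ℕ → A → Set) →
  (∀ x a → P (toℕ x) a → P (suc (toℕ x)) (f a x)) →
  ∀ {m} c (g : Fin m → Fin n) → (∀ x → toℕ (g x) ≡ c + toℕ x) →
  ∀ {a} → P c a → P (c + m) (foldl f a (tabulate g))
foldl-tabulate-induction f P step {zero} c g g≡ {a} Pa = subst (λ k → P k a) (sym (+-identityʳ c)) Pa
foldl-tabulate-induction f P step {suc m} c g g≡ {a} Pa =
  subst (λ k → P k (foldl f (f a (g zero)) (tabulate (g ∘ suc)))) (sym (+-suc c m))
    (foldl-tabulate-induction f P step (suc c) (g ∘ suc) (λ x → trans (g≡ (suc x)) (+-suc c (toℕ x)))
      (step-at (trans (g≡ zero) (+-identityʳ c)) Pa))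
  where
  step-at : ∀ {x a k} → toℕ x ≡ k → P k a → P (suc k) (f a x)
  step-at refl = step _ _

foldl-allFin-induction : ∀ {A : Set} {n} (f : A → Fin n → A) (P : ℕ → A → Set) →
  (∀ x a → P (toℕ x) a → P (suc (toℕ x)) (f a x)) →
  ∀ {a} → P 0 a → P n (foldl f a (allFin n))
foldl-allFin-induction f P step = foldl-tabulate-induction f P step 0 id (λ _ → refl)

toℕ<suc⇒<∨≡ : ∀ {n} {i j : Fin n} → toℕ i < suc (toℕ j) → toℕ i < toℕ j ⊎ i ≡ j
toℕ<suc⇒<∨≡ lt with m<1+n⇒m<n∨m≡n lt
... | inj₁ i<j = inj₁ i<j
... | inj₂ i≡j = inj₂ (toℕ-injective i≡j)

module _ {n : ℕ} where

  infix 4 _⊆_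
  _⊆_ : Matrix n → Matrix n → Set
  b ⊆ a = ∀ r s → b r s ≡ true → a r s ≡ true

  ⊆-trans : ∀ {c b a} → c ⊆ b → b ⊆ a → c ⊆ a
  ⊆-trans c⊆b b⊆a r s = b⊆a r s ∘ c⊆b r s

  clear-⊆ : ∀ (p q : Fin n) a → clear p q a ⊆ a
  clear-⊆ p q a r s h with does (r ≟ p) | does (s ≟ q)
  clear-⊆ p q a r s () | true | true
  ... | true | false = h
  ... | false | _ = h

  clear-keeps : ∀ (p q : Fin n) a r s → a r s ≡ true → (r ≡ p → s ≢ q) → clear p q a r s ≡ true
  clear-keeps p q a r s h r≡p→s≢q with r ≟ p | s ≟ q
  ... | yes r≡p | yes s≡q = ⊥-elim (r≡p→s≢q r≡p s≡q)
  ... | yes _ | no _ = h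
  ... | no _ | _ = h

  clear-clears : ∀ (p q : Fin n) a → clear p q a p q ≡ false
  clear-clears p q a rewrite dec-true (p ≟ p) refl | dec-true (q ≟ q) refl = refl

  clearUnless : ∀ {X : Set} → Dec X → Bool → Fin n → Fin n → Matrix n → Matrix n
  clearUnless x? c p q a = if does x? then a else (if c then a else clear p q a)

  clearUnless-⊆ : ∀ {X : Set} (x? : Dec X) c (p q : Fin n) a → clearUnless x? c p q a ⊆ a
  clearUnless-⊆ (yes _) c p q a r s h = h
  clearUnless-⊆ (no _) true p q a r s h = h
  clearUnless-⊆ (no _) false p q a = clear-⊆ p q a

  clearUnless-keeps : ∀ {X : Set} (x? : Dec X) c (p q : Fin n) a r s →
    a r s ≡ true → (r ≡ p → s ≡ q → c ≡ true) → clearUnless x? c p q a r s ≡ true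
  clearUnless-keeps (yes _) c p q a r s h _ = h
  clearUnless-keeps (no _) true p q a r s h _ = h
  clearUnless-keeps (no _) false p q a r s h c-holds =
    clear-keeps p q a r s h (λ r≡p s≡q → case-false (c-holds r≡p s≡q))
    where
    case-false : false ≢ true
    case-false ()

  clearUnless-cleared : ∀ {X : Set} (x? : Dec X) c (p q : Fin n) a →
    ¬ X → clearUnless x? c p q a p q ≡ true → c ≡ true
  clearUnless-cleared (yes x) c p q a ¬x _ = ⊥-elim (¬x x)
  clearUnless-cleared (no _) true p q a _ _ = refl
  clearUnless-cleared (no _) false p q a _ h with trans (sym (clear-clears p q a)) h
  ... | ()

  Closed : Matrix n → Fin n → Fin n → Set
  Closed a i j = a i j ≡ true → ∀ k → (a j k ≡ true → a i k ≡ true) × (a k i ≡ true → a k j ≡ true)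

  closed-refl : ∀ a (i : Fin n) → Closed a i i
  closed-refl a i _ _ = id , id

  closed-of-false : ∀ a (i j : Fin n) → a i j ≡ false → Closed a i j
  closed-of-false a i j aij≡false aij≡true with trans (sym aij≡false) aij≡true
  ... | ()

  closed⇒transitive : ∀ a → (∀ i j → Closed a i j) → Transitive a
  closed⇒transitive a closed i j k aij ajk = proj₁ (closed i j aij k) ajk

  RowsClosed : ℕ → Matrix n → Set
  RowsClosed r a = ∀ i j → toℕ i < r → Closed a i j

  ClosedBefore : Fin n → ℕ → Matrix n → Set
  ClosedBefore p s a = RowsClosed (toℕ p) a × (∀ j → toℕ j < s → Closed a p j)

  closedBefore-extend : ∀ {p q a} → ClosedBefore p (toℕ q) a → Closed a p q → ClosedBefore p (suc (toℕ q)) a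
  closedBefore-extend {p} {q} {a} (rows , rowP) pq = rows , rowP′
    where
    rowP′ : ∀ j → toℕ j < suc (toℕ q) → Closed a p j
    rowP′ j lt with toℕ<suc⇒<∨≡ lt
    ... | inj₁ j<q = rowP j j<q
    ... | inj₂ refl = pq

module Pruning {n} (a : Matrix n) {p q : Fin n} (p≢q : p ≢ q) (apq : a p q ≡ true) where

  Compatible : Fin n → Fin n → Set
  Compatible r s = (r ≡ q → a p s ≡ true) × (s ≡ p → a r q ≡ true)

  compatible-row : ∀ s → Compatible p s
  compatible-row s = (λ p≡q → ⊥-elim (p≢q p≡q)) , (λ _ → apq)

  compatible-col : ∀ r → Compatible r q
  compatible-col r = (λ _ → apq) , (λ q≡p → ⊥-elim (p≢q (sym q≡p)))

  -- Step k touches only the entries (q, k) and (k, p), so the k-loop leaves exactly the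
  -- entries of a that are compatible with (p, q).
  record PrunedBelow (c : ℕ) (b : Matrix n) : Set where
    field
      ⊆-orig : b ⊆ a
      row : ∀ s → toℕ s < c → b q s ≡ true → a p s ≡ true
      col : ∀ r → toℕ r < c → b r p ≡ true → a r q ≡ true
      keeps : ∀ r s → a r s ≡ true → Compatible r s → b r s ≡ true

  prunedBelow-zero : PrunedBelow 0 a
  prunedBelow-zero = record
    { ⊆-orig = λ _ _ → id
    ; row = λ _ s<0 _ → ⊥-elim (n≮0 s<0)
    ; col = λ _ r<0 _ → ⊥-elim (n≮0 r<0)
    ; keeps = λ _ _ h _ → h
    }

  prunedBelow-suc : ∀ k b → PrunedBelow (toℕ k) b → PrunedBelow (suc (toℕ k)) (stepK p q b k)
  prunedBelow-suc k b inv = record { ⊆-orig = ⊆-orig′ ; row = row′ ; col = col′ ; keeps = keeps′ }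
    where
    open PrunedBelow inv
    b₁ = stepA p q k b
    b₂ = stepB p q k b₁
    b₁⊆b : b₁ ⊆ b
    b₁⊆b = clearUnless-⊆ (k ≟ q) (b p k) q k b
    b₂⊆b₁ : b₂ ⊆ b₁
    b₂⊆b₁ = clearUnless-⊆ (k ≟ p) (b₁ k q) k p b₁
    ⊆-orig′ : b₂ ⊆ a
    ⊆-orig′ = ⊆-trans b₂⊆b₁ (⊆-trans b₁⊆b ⊆-orig)

    row′ : ∀ s → toℕ s < suc (toℕ k) → b₂ q s ≡ true → a p s ≡ true
    row′ s lt h with toℕ<suc⇒<∨≡ lt
    ... | inj₁ s<k = row s s<k (b₁⊆b q s (b₂⊆b₁ q s h))
    ... | inj₂ refl = row-k (k ≟ q)
      where
      row-k : Dec (k ≡ q) → a p k ≡ true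
      row-k (yes k≡q) = subst (λ x → a p x ≡ true) (sym k≡q) apq
      row-k (no k≢q) = ⊆-orig p k (clearUnless-cleared (k ≟ q) (b p k) q k b k≢q (b₂⊆b₁ q k h))

    col′ : ∀ r → toℕ r < suc (toℕ k) → b₂ r p ≡ true → a r q ≡ true
    col′ r lt h with toℕ<suc⇒<∨≡ lt
    ... | inj₁ r<k = col r r<k (b₁⊆b r p (b₂⊆b₁ r p h))
    ... | inj₂ refl = col-k (k ≟ p)
      where
      col-k : Dec (k ≡ p) → a k q ≡ true
      col-k (yes k≡p) = subst (λ x → a x q ≡ true) (sym k≡p) apq
      col-k (no k≢p) = ⊆-orig k q (b₁⊆b k q (clearUnless-cleared (k ≟ p) (b₁ k q) k p b₁ k≢p h))

    keeps′ : ∀ r s → a r s ≡ true → Compatible r s → b₂ r s ≡ true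
    keeps′ r s ars (if-q , if-p) =
      clearUnless-keeps (k ≟ p) (b₁ k q) k p b₁ r s
        (clearUnless-keeps (k ≟ q) (b p k) q k b r s (keeps r s ars (if-q , if-p))
          (λ { refl refl → keeps p k (if-q refl) (compatible-row k) }))
        (λ { refl refl → clearUnless-keeps (k ≟ q) (b p k) q k b k q
                           (keeps k q (if-p refl) (compatible-col k))
                           (λ { _ refl → keeps p q apq (compatible-row q) }) })

  pruned : Matrix n
  pruned = foldl (stepK p q) a (allFin n)

  open PrunedBelow (foldl-allFin-induction (stepK p q) PrunedBelow prunedBelow-suc prunedBelow-zero)

  pruned-compatible : ∀ {r s} → pruned r s ≡ true → Compatible r s
  pruned-compatible {r} {s} h = (λ { refl → row s (toℕ<n s) h }) , (λ { refl → col r (toℕ<n r) h })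

  new-pair-closed : Closed pruned p q
  new-pair-closed _ k =
    (λ bqk → keeps p k (row k (toℕ<n k) bqk) (compatible-row k)) ,
    (λ bkp → keeps k q (col k (toℕ<n k) bkp) (compatible-col k))

  old-pair-closed : ∀ {i j} → Closed a i j → (i ≡ q → ∀ k → Closed a q k) →
    (j ≡ p → i ≡ p ⊎ Closed a i q) → Closed pruned i j
  old-pair-closed {i} {j} closed rowQ colP bij k = row-part , col-part
    where
    aij = ⊆-orig i j bij
    row-part : pruned j k ≡ true → pruned i k ≡ true
    row-part bjk = keeps i k aik
      ( (λ { refl → proj₂ (rowQ refl k aik p) apq })
      , (λ { refl → proj₁ (closed aij q) (proj₂ (pruned-compatible bjk) refl) }) )
      where aik = proj₁ (closed aij k) (⊆-orig j k bjk)
    col-part : pruned k i ≡ true → pruned k j ≡ true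
    col-part bki = keeps k j (proj₂ (closed aij k) aki)
      ( (λ { refl → proj₂ (closed aij p) (proj₁ (pruned-compatible bki) refl) })
      , (λ j≡p → col-p j≡p (colP j≡p)) )
      where
      aki = ⊆-orig k i bki
      col-p : j ≡ p → i ≡ p ⊎ Closed a i q → a k q ≡ true
      col-p _ (inj₁ i≡p) = proj₂ (pruned-compatible bki) i≡p
      col-p j≡p (inj₂ closed-iq) = proj₂ (closed-iq (proj₂ (pruned-compatible bij) j≡p) k) aki

  closedBefore-prune : ClosedBefore p (toℕ q) a → ClosedBefore p (suc (toℕ q)) pruned
  closedBefore-prune (rows , rowP) = closedBefore-extend (rows′ , rowP′) new-pair-closed
    where
    rows′ : RowsClosed (toℕ p) pruned
    rows′ i j i<p = old-pair-closed {i} {j} (rows i j i<p)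
      (λ { refl k → rows q k i<p })
      (λ _ → inj₂ (rows i q i<p))
    rowP′ : ∀ j → toℕ j < toℕ q → Closed pruned p j
    rowP′ j j<q = old-pair-closed {p} {j} (rowP j j<q) (λ p≡q → ⊥-elim (p≢q p≡q)) (λ _ → inj₁ refl)

module _ {n : ℕ} where

  closedBefore-stepJ : ∀ (p : Fin n) a q → ClosedBefore p (toℕ q) a → ClosedBefore p (suc (toℕ q)) (stepJ p a q)
  closedBefore-stepJ p a q inv with q ≟ p | a p q in apq
  ... | yes refl | _ = closedBefore-extend inv (closed-refl a p)
  ... | no _ | false = closedBefore-extend inv (closed-of-false a p q apq)
  ... | no q≢p | true = Pruning.closedBefore-prune a (≢-sym q≢p) apq inv

  closedBefore⇒rowsClosed : ∀ {p : Fin n} {a} → ClosedBefore p n a → RowsClosed (suc (toℕ p)) a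
  closedBefore⇒rowsClosed (rows , rowP) i j lt with toℕ<suc⇒<∨≡ lt
  ... | inj₁ i<p = rows i j i<p
  ... | inj₂ refl = rowP j (toℕ<n j)

  rowsClosed-stepI : ∀ a (p : Fin n) → RowsClosed (toℕ p) a → RowsClosed (suc (toℕ p)) (stepI a p)
  rowsClosed-stepI a p rows = closedBefore⇒rowsClosed
    (foldl-allFin-induction (stepJ p) (ClosedBefore p) (λ q b → closedBefore-stepJ p b q)
      (rows , λ _ j<0 → ⊥-elim (n≮0 j<0)))

  algorithm1-rowsClosed : ∀ (A : Matrix n) → RowsClosed n (algorithm1 A)
  algorithm1-rowsClosed A = foldl-allFin-induction stepI RowsClosed (λ p a → rowsClosed-stepI a p)
    (λ _ _ i<0 → ⊥-elim (n≮0 i<0))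

lemma2 : ∀ (n : ℕ) (A : Matrix n) → Transitive (algorithm1 A)
lemma2 n A = closed⇒transitive (algorithm1 A) (λ i j → algorithm1-rowsClosed A i j (toℕ<n i))
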